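{- LCTR is conjugate-invariant: for every partition $\lambda$, $\mathrm{SG}(\lambda')=\mathrm{SG}(\lambda)$.
   Context: A partition is a finite weakly decreasing sequence $\lambda=(\lambda_1,\dots,\lambda_k)$ of positive integers; its conjugate is $\lambda'$ with $\lambda'_j=|\{i:\lambda_i\ge j\}|$. LCTR: from a nonempty $\lambda$ one may move to $T(\lambda)=(\lambda_2,\dots,\lambda_k)$ or $L(\lambda)=(\lambda_1-1,\dots,\lambda_k-1)$ (nonpositive entries omitted); $()$ has no moves. $\mathrm{SG}(())=0$, $\mathrm{SG}(\lambda)=\mathrm{mex}\{\mathrm{SG}(L(\lambda)),\mathrm{SG}(T(\lambda))\}$ otherwise, where $\mathrm{mex}(B)$ is the least nonnegative integer not in $B$. -}

module Defs where

open import Data.Nat using (ℕ; zero; suc; _+_; _∸_; _≤_; _≤ᵇ_; _≥_)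
open import Data.List using (List; []; _∷_; map; filter; length)
open import Data.Nat.ListAction using (sum)
open import Data.List.Membership.DecPropositional (Data.Nat._≟_) using (_∈?_)
open import Relation.Nullary.Decidable using (does)
import Data.Nat
open import Data.List.Relation.Unary.All using (All)
open import Data.List.Relation.Unary.Linked using (Linked)
open import Data.Nat using (NonZero)
open import Data.Bool using (Bool; true; false; if_then_else_)
open import Relation.Binary.PropositionalEquality using (_≡_)

record IsPartition (xs : List ℕ) : Set where
  field
    positive   : All (λ x → 1 ≤ x) xs
    decreasing : Linked _≥_ xs

dropZeros : List ℕ → List ℕ
dropZeros [] = []
dropZeros (zero ∷ xs) = dropZeros xs
dropZeros (suc x ∷ xs) = suc x ∷ dropZeros xs

moveL : List ℕ → List ℕ
moveL xs = dropZeros (map (λ x → x ∸ 1) xs)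

moveT : List ℕ → List ℕ
moveT [] = []
moveT (_ ∷ xs) = xs

countGe : ℕ → List ℕ → ℕ
countGe j [] = 0
countGe j (x ∷ xs) = if j ≤ᵇ x then suc (countGe j xs) else countGe j xs

conjFrom : ℕ → ℕ → List ℕ → List ℕ
conjFrom j zero xs = []
conjFrom j (suc k) xs = countGe j xs ∷ conjFrom (suc j) k xs

conjugate : List ℕ → List ℕ
conjugate [] = []
conjugate (x ∷ xs) = conjFrom 1 x (x ∷ xs)

-- mex(B): least n not in B; searching from 0 with fuel (length B + 1 suffices)
mexFrom : ℕ → ℕ → List ℕ → ℕ
mexFrom n zero B = n
mexFrom n (suc k) B = if does (n ∈? B) then mexFrom (suc n) k B else n

mex : List ℕ → ℕ
mex B = mexFrom 0 (suc (length B)) B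

-- Sprague–Grundy value with fuel; for a partition, both moves strictly
-- decrease (sum + length), so fuel = sum + length suffices.
sgFuel : ℕ → List ℕ → ℕ
sgFuel _ [] = 0
sgFuel zero (_ ∷ _) = 0
sgFuel (suc n) (x ∷ xs) = mex (sgFuel n (moveL (x ∷ xs)) ∷ sgFuel n (moveT (x ∷ xs)) ∷ [])

SG : List ℕ → ℕ
SG xs = sgFuel (sum xs + length xs) xs

{-# OPTIONS --safe #-}
-- Conjugation exchanges the two moves: T(λ)' = L(λ') and L(λ)' = T(λ').  So, by induction
-- on |λ| + length λ, SG(λ') is the mex of the same two values as SG(λ), taken in the
-- other order.
module Submission where

open import Defs
open import Data.Nat using (ℕ; zero; suc; _+_; _∸_; _≤_; _<_; _≥_; _≤ᵇ_; _<ᵇ_; z≤n; s≤s)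
open import Data.Nat.Properties
open import Data.Nat.ListAction using (sum)
open import Data.List using (List; []; _∷_; map; length; _++_; filter)
open import Data.List.Properties using (map-∘; map-id; filter-++; ++-identityʳ)
open import Data.List.Relation.Unary.All as All using (All; []; _∷_)
open import Data.List.Relation.Unary.All.Properties using (all-filter)
open import Data.List.Relation.Unary.Linked as Linked using (Linked)
open import Data.List.Relation.Unary.Linked.Properties using (Linked⇒All; map⁺; filter⁺)
open import Data.List.Membership.DecPropositional (_≟_) using (_∈?_)
open import Data.Bool using (true; false)
open import Data.Empty using (⊥-elim)
open import Function using (flip)
open import Relation.Nullary.Decidable using (does)
open import Relation.Binary.PropositionalEquality

decreasing⇒≤head : ∀ {x xs} → Linked _≥_ (x ∷ xs) → All (_≤ x) (x ∷ xs)
decreasing⇒≤head = Linked⇒All (flip ≤-trans) ≤-refl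

dropZeros≗filter : ∀ xs → dropZeros xs ≡ filter (1 ≤?_) xs
dropZeros≗filter []           = refl
dropZeros≗filter (zero ∷ xs)  = dropZeros≗filter xs
dropZeros≗filter (suc x ∷ xs) = cong (suc x ∷_) (dropZeros≗filter xs)

dropZeros-++ : ∀ xs ys → dropZeros (xs ++ ys) ≡ dropZeros xs ++ dropZeros ys
dropZeros-++ xs ys = begin
  dropZeros (xs ++ ys)                      ≡⟨ dropZeros≗filter (xs ++ ys) ⟩
  filter (1 ≤?_) (xs ++ ys)                 ≡⟨ filter-++ (1 ≤?_) xs ys ⟩
  filter (1 ≤?_) xs ++ filter (1 ≤?_) ys    ≡⟨ sym (cong₂ _++_ (dropZeros≗filter xs) (dropZeros≗filter ys)) ⟩
  dropZeros xs ++ dropZeros ys              ∎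
  where open ≡-Reasoning

dropZeros-map-suc : ∀ xs → dropZeros (map suc xs) ≡ map suc xs
dropZeros-map-suc []       = refl
dropZeros-map-suc (x ∷ xs) = cong (suc x ∷_) (dropZeros-map-suc xs)

moveL-map-suc : ∀ xs → moveL (map suc xs) ≡ dropZeros xs
moveL-map-suc xs = cong dropZeros (trans (sym (map-∘ xs)) (map-id xs))

moveL-≤1 : ∀ {xs} → All (_≤ 1) xs → moveL xs ≡ []
moveL-≤1 []             = refl
moveL-≤1 (z≤n ∷ ps)     = moveL-≤1 ps
moveL-≤1 (s≤s z≤n ∷ ps) = moveL-≤1 ps

moveL-IsPartition : ∀ {xs} → IsPartition xs → IsPartition (moveL xs)
moveL-IsPartition {xs} P = record
  { positive   = subst (All (1 ≤_)) (sym eq) (all-filter (1 ≤?_) (map (_∸ 1) xs))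
  ; decreasing = subst (Linked _≥_) (sym eq)
      (filter⁺ (1 ≤?_) (flip ≤-trans) (map⁺ (Linked.map (∸-monoˡ-≤ 1) (IsPartition.decreasing P))))
  }
  where
    eq : dropZeros (map (_∸ 1) xs) ≡ filter (1 ≤?_) (map (_∸ 1) xs)
    eq = dropZeros≗filter (map (_∸ 1) xs)

moveT-IsPartition : ∀ {x xs} → IsPartition (x ∷ xs) → IsPartition (moveT (x ∷ xs))
moveT-IsPartition P = record
  { positive   = All.tail (IsPartition.positive P)
  ; decreasing = Linked.tail (IsPartition.decreasing P)
  }

countGe-≤ : ∀ {j x} xs → j ≤ x → countGe j (x ∷ xs) ≡ suc (countGe j xs)
countGe-≤ {j} {x} xs j≤x with j ≤ᵇ x | ≤⇒≤ᵇ j≤x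
... | true | _ = refl

countGe-> : ∀ {j x} xs → x < j → countGe j (x ∷ xs) ≡ countGe j xs
countGe-> {j} {x} xs x<j with j ≤ᵇ x | ≤ᵇ⇒≤ j x
... | false | _   = refl
... | true  | j≤x = ⊥-elim (<⇒≱ x<j (j≤x _))

countGe-beyond : ∀ {j xs} → All (_< j) xs → countGe j xs ≡ 0
countGe-beyond []                     = refl
countGe-beyond {xs = _ ∷ xs} (p ∷ ps) = trans (countGe-> xs p) (countGe-beyond ps)

countGe-moveL : ∀ j xs → countGe (suc j) (moveL xs) ≡ countGe (suc (suc j)) xs
countGe-moveL j []                 = refl
countGe-moveL j (zero ∷ xs)        = countGe-moveL j xs
countGe-moveL j (suc zero ∷ xs)    = countGe-moveL j xs
countGe-moveL j (suc (suc x) ∷ xs) with j <ᵇ suc x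
... | true  = cong suc (countGe-moveL j xs)
... | false = countGe-moveL j xs

conjFrom-++ : ∀ xs j a b → conjFrom j (a + b) xs ≡ conjFrom j a xs ++ conjFrom (j + a) b xs
conjFrom-++ xs j zero    b rewrite +-identityʳ j = refl
conjFrom-++ xs j (suc a) b rewrite +-suc j a     = cong (countGe j xs ∷_) (conjFrom-++ xs (suc j) a b)

conjFrom-cons : ∀ {x} xs j k → j + k ≤ suc x → conjFrom j k (x ∷ xs) ≡ map suc (conjFrom j k xs)
conjFrom-cons xs j zero    _ = refl
conjFrom-cons {x} xs j (suc k) h =
  cong₂ _∷_ (countGe-≤ xs (m+n≤o⇒m≤o j (≤-pred h′))) (conjFrom-cons xs (suc j) k h′)
  where
    h′ : suc j + k ≤ suc x
    h′ = subst (_≤ suc x) (+-suc j k) h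

dropZeros-conjFrom-beyond : ∀ {j xs} k → All (_< j) xs → dropZeros (conjFrom j k xs) ≡ []
dropZeros-conjFrom-beyond zero    _  = refl
dropZeros-conjFrom-beyond (suc k) ps rewrite countGe-beyond ps =
  dropZeros-conjFrom-beyond k (All.map m≤n⇒m≤1+n ps)

conjFrom-moveL : ∀ j k xs → conjFrom (suc j) k (moveL xs) ≡ conjFrom (suc (suc j)) k xs
conjFrom-moveL j zero    xs = refl
conjFrom-moveL j (suc k) xs = cong₂ _∷_ (countGe-moveL j xs) (conjFrom-moveL (suc j) k xs)

dropZeros-conjugate : ∀ x xs → dropZeros (conjugate (x ∷ xs)) ≡ conjugate (x ∷ xs)
dropZeros-conjugate x xs =
  trans (cong dropZeros eq) (trans (dropZeros-map-suc _) (sym eq))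
  where
    eq : conjugate (x ∷ xs) ≡ map suc (conjFrom 1 x xs)
    eq = conjFrom-cons xs 1 x ≤-refl

-- Columns beyond the first row of xs have length zero and are discarded.
dropZeros-conjFrom-≥head : ∀ {x xs} → Linked _≥_ xs → All (_≤ x) xs →
                           dropZeros (conjFrom 1 x xs) ≡ conjugate xs
dropZeros-conjFrom-≥head {x} {[]}     _   _         = dropZeros-conjFrom-beyond x []
dropZeros-conjFrom-≥head {x} {y ∷ ys} dec (y≤x ∷ _) = begin
  dropZeros (conjFrom 1 x (y ∷ ys))
    ≡⟨ cong (λ k → dropZeros (conjFrom 1 k (y ∷ ys))) (sym (m+[n∸m]≡n y≤x)) ⟩
  dropZeros (conjFrom 1 (y + (x ∸ y)) (y ∷ ys))
    ≡⟨ cong dropZeros (conjFrom-++ (y ∷ ys) 1 y (x ∸ y)) ⟩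
  dropZeros (conjugate (y ∷ ys) ++ conjFrom (suc y) (x ∸ y) (y ∷ ys))
    ≡⟨ dropZeros-++ (conjugate (y ∷ ys)) _ ⟩
  dropZeros (conjugate (y ∷ ys)) ++ dropZeros (conjFrom (suc y) (x ∸ y) (y ∷ ys))
    ≡⟨ cong₂ _++_ (dropZeros-conjugate y ys)
                  (dropZeros-conjFrom-beyond (x ∸ y) (All.map s≤s (decreasing⇒≤head dec))) ⟩
  conjugate (y ∷ ys) ++ []
    ≡⟨ ++-identityʳ _ ⟩
  conjugate (y ∷ ys) ∎
  where open ≡-Reasoning

conjugate-moveT : ∀ {x xs} → Linked _≥_ (x ∷ xs) → conjugate (moveT (x ∷ xs)) ≡ moveL (conjugate (x ∷ xs))
conjugate-moveT {x} {xs} dec = sym (begin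
  moveL (conjugate (x ∷ xs))          ≡⟨ cong moveL (conjFrom-cons xs 1 x ≤-refl) ⟩
  moveL (map suc (conjFrom 1 x xs))   ≡⟨ moveL-map-suc (conjFrom 1 x xs) ⟩
  dropZeros (conjFrom 1 x xs)         ≡⟨ dropZeros-conjFrom-≥head (Linked.tail dec) (All.tail (decreasing⇒≤head dec)) ⟩
  conjugate xs                        ∎)
  where open ≡-Reasoning

conjugate-moveL : ∀ {x xs} → IsPartition (x ∷ xs) → conjugate (moveL (x ∷ xs)) ≡ moveT (conjugate (x ∷ xs))
conjugate-moveL {zero}        P with IsPartition.positive P
... | () ∷ _
conjugate-moveL {suc zero}    P = cong conjugate (moveL-≤1 (All.tail (decreasing⇒≤head (IsPartition.decreasing P))))
conjugate-moveL {suc (suc x)} _ = conjFrom-moveL 0 (suc x) _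

weight : List ℕ → ℕ
weight xs = sum xs + length xs

weight-moveL≤sum : ∀ xs → weight (moveL xs) ≤ sum xs
weight-moveL≤sum []                 = z≤n
weight-moveL≤sum (zero ∷ xs)        = weight-moveL≤sum xs
weight-moveL≤sum (suc zero ∷ xs)    = m≤n⇒m≤1+n (weight-moveL≤sum xs)
weight-moveL≤sum (suc (suc x) ∷ xs) = begin
  (suc x + sum (moveL xs)) + suc (length (moveL xs)) ≡⟨ +-suc (suc x + sum (moveL xs)) _ ⟩
  suc ((suc x + sum (moveL xs)) + length (moveL xs)) ≡⟨ cong suc (+-assoc (suc x) _ _) ⟩
  suc (suc x + weight (moveL xs))                    ≤⟨ s≤s (+-monoʳ-≤ (suc x) (weight-moveL≤sum xs)) ⟩
  suc (suc x + sum xs)                               ∎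
  where open ≤-Reasoning

weight-moveL< : ∀ x xs → weight (moveL (x ∷ xs)) < weight (x ∷ xs)
weight-moveL< x xs = ≤-<-trans (weight-moveL≤sum (x ∷ xs)) (m<m+n (sum (x ∷ xs)) (s≤s z≤n))

weight-moveT< : ∀ x xs → weight (moveT (x ∷ xs)) < weight (x ∷ xs)
weight-moveT< x xs = +-mono-≤-< (m≤n+m (sum xs) x) (n<1+n (length xs))

sgFuel-stable : ∀ m n xs → weight xs ≤ m → weight xs ≤ n → sgFuel m xs ≡ sgFuel n xs
sgFuel-stable _       _       []       _ _ = refl
sgFuel-stable zero    _       (x ∷ xs) p _ with () ← <-≤-trans (weight-moveT< x xs) p
sgFuel-stable (suc m) zero    (x ∷ xs) _ q with () ← <-≤-trans (weight-moveT< x xs) q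
sgFuel-stable (suc m) (suc n) (x ∷ xs) p q = cong₂ (λ a b → mex (a ∷ b ∷ []))
  (sgFuel-stable m n (moveL (x ∷ xs)) (below (weight-moveL< x xs) p) (below (weight-moveL< x xs) q))
  (sgFuel-stable m n xs (below (weight-moveT< x xs) p) (below (weight-moveT< x xs) q))
  where
    below : ∀ {a k} → a < weight (x ∷ xs) → weight (x ∷ xs) ≤ suc k → a ≤ k
    below a< ≤k = ≤-pred (<-≤-trans a< ≤k)

SG-unfold : ∀ x xs → SG (x ∷ xs) ≡ mex (SG (moveL (x ∷ xs)) ∷ SG (moveT (x ∷ xs)) ∷ [])
SG-unfold x xs = trans
  (sgFuel-stable _ (suc (weight (x ∷ xs))) (x ∷ xs) ≤-refl (n≤1+n _))
  (cong₂ (λ a b → mex (a ∷ b ∷ []))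
    (sgFuel-stable _ _ (moveL (x ∷ xs)) (<⇒≤ (weight-moveL< x xs)) ≤-refl)
    (sgFuel-stable _ _ xs (<⇒≤ (weight-moveT< x xs)) ≤-refl))

∈-swap : ∀ n a b → does (n ∈? (a ∷ b ∷ [])) ≡ does (n ∈? (b ∷ a ∷ []))
∈-swap n a b with does (n ≟ a) | does (n ≟ b)
... | true  | true  = refl
... | true  | false = refl
... | false | true  = refl
... | false | false = refl

mexFrom-swap : ∀ n k a b → mexFrom n k (a ∷ b ∷ []) ≡ mexFrom n k (b ∷ a ∷ [])
mexFrom-swap n zero    a b = refl
mexFrom-swap n (suc k) a b rewrite ∈-swap n a b with does (n ∈? (b ∷ a ∷ []))
... | true  = mexFrom-swap (suc n) k a b
... | false = refl

mex-swap : ∀ a b → mex (a ∷ b ∷ []) ≡ mex (b ∷ a ∷ [])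
mex-swap a b = mexFrom-swap 0 3 a b

SG-conjugate-bounded : ∀ n xs → weight xs ≤ n → IsPartition xs → SG (conjugate xs) ≡ SG xs
SG-conjugate-bounded _       []           _ _ = refl
SG-conjugate-bounded zero    (x ∷ xs)     p _ with () ← <-≤-trans (weight-moveT< x xs) p
SG-conjugate-bounded (suc n) (zero ∷ xs)  _ P with IsPartition.positive P
... | () ∷ _
SG-conjugate-bounded (suc n) (suc x ∷ xs) p P = begin
  SG (conjugate λs)
    ≡⟨ SG-unfold (countGe 1 λs) (conjFrom 2 x λs) ⟩
  mex (SG (moveL (conjugate λs)) ∷ SG (moveT (conjugate λs)) ∷ [])
    ≡⟨ cong₂ (λ a b → mex (SG a ∷ SG b ∷ []))
             (sym (conjugate-moveT (IsPartition.decreasing P))) (sym (conjugate-moveL P)) ⟩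
  mex (SG (conjugate (moveT λs)) ∷ SG (conjugate (moveL λs)) ∷ [])
    ≡⟨ cong₂ (λ a b → mex (a ∷ b ∷ []))
             (SG-conjugate-bounded n _ (below (weight-moveT< (suc x) xs)) (moveT-IsPartition P))
             (SG-conjugate-bounded n _ (below (weight-moveL< (suc x) xs)) (moveL-IsPartition P)) ⟩
  mex (SG (moveT λs) ∷ SG (moveL λs) ∷ [])
    ≡⟨ mex-swap (SG (moveT λs)) (SG (moveL λs)) ⟩
  mex (SG (moveL λs) ∷ SG (moveT λs) ∷ [])
    ≡⟨ SG-unfold (suc x) xs ⟨
  SG λs ∎
  where
    open ≡-Reasoning
    λs : List ℕ
    λs = suc x ∷ xs
    below : ∀ {a} → a < weight λs → a ≤ n
    below a< = ≤-pred (<-≤-trans a< p)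

lemma3p3 : (λs : List ℕ) → IsPartition λs → SG (conjugate λs) ≡ SG λs
lemma3p3 λs P = SG-conjugate-bounded (weight λs) λs ≤-refl P
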